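{- Let $G$ be a free graph. Then $\phi(G)\leq \chi(G)+d(G)$. Moreover, if the girth $g(G)\geq 5$, then $\phi(G)\leq \chi(G)+4$.
   Context: All graphs are finite and simple; $N(v)$ is the open neighborhood of $v$; $g(G)$ is the girth of $G$. An independent set $F$ of $G$ is a free independent set if it is contained in at least two distinct maximal independent sets of $G$ (equivalently, there is an edge $uv$ with $(N(u)\cup N(v))\cap F=\emptyset$). $G$ is a free graph if every vertex lies in some free independent set. The free chromatic number $\phi(G)$ is the minimum $t$ such that $V(G)$ can be partitioned into $t$ free independent sets. For an edge $e=uv$, $d(e)=|N(u)\cup N(v)|$, and $d(G)=\min\{d(e): e\in E(G)\}$. -}

module Defs where

open import Data.Nat using (ℕ; _≤_; _+_)
open import Data.Fin using (Fin; _≟_)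
open import Data.Fin.Subset using (Subset; _∈_; _⊆_; _∪_; ∣_∣)
open import Data.Vec using (tabulate)
open import Data.Product using (Σ; ∃; _×_; Σ-syntax; ∃-syntax)
open import Relation.Nullary using (¬_; Dec; does)
open import Relation.Binary.PropositionalEquality using (_≡_; _≢_)
open import Level using (0ℓ)

record Graph (n : ℕ) : Set₁ where
  field
    Adj    : Fin n → Fin n → Set
    adj?   : (u v : Fin n) → Dec (Adj u v)
    sym    : ∀ {u v} → Adj u v → Adj v u
    irrefl : ∀ {u} → ¬ Adj u u

module _ {n : ℕ} (G : Graph n) where
  open Graph G

  N : Fin n → Subset n
  N v = tabulate (λ w → does (adj? v w))

  d-edge : Fin n → Fin n → ℕ
  d-edge u v = ∣ N u ∪ N v ∣

  Independent : Subset n → Set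
  Independent F = ∀ u v → u ∈ F → v ∈ F → ¬ Adj u v

  MaximalIndependent : Subset n → Set
  MaximalIndependent M =
    Independent M × (∀ F → Independent F → M ⊆ F → F ≡ M)

  FreeIndependent : Subset n → Set
  FreeIndependent F =
    Independent F ×
    Σ[ M₁ ∈ Subset n ] Σ[ M₂ ∈ Subset n ]
      (MaximalIndependent M₁ × MaximalIndependent M₂ ×
       F ⊆ M₁ × F ⊆ M₂ × M₁ ≢ M₂)

  FreeGraph : Set
  FreeGraph = ∀ v → Σ[ F ∈ Subset n ] (FreeIndependent F × v ∈ F)

  -- proper k-colouring (witnesses χ(G) ≤ k)
  Colorable : ℕ → Set
  Colorable k = Σ[ c ∈ (Fin n → Fin k) ] (∀ u v → Adj u v → c u ≢ c v)

  colorClass : ∀ {t} → (Fin n → Fin t) → Fin t → Subset n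
  colorClass c i = tabulate (λ v → does (c v ≟ i))

  -- partition of V(G) into (at most) t free independent sets,
  -- given as a colouring all of whose colour classes are free independent sets
  -- (witnesses φ(G) ≤ t)
  FreeColorable : ℕ → Set
  FreeColorable t =
    Σ[ c ∈ (Fin n → Fin t) ] (∀ i → FreeIndependent (colorClass c i))

  NoTriangle : Set
  NoTriangle = ∀ a b c → Adj a b → Adj b c → Adj c a → Data.Empty.⊥
    where import Data.Empty

  Girth≥5 : Set
  Girth≥5 = NoTriangle ×
    (∀ a b c d → a ≢ c → b ≢ d →
       Adj a b → Adj b c → Adj c d → Adj d a → Data.Empty.⊥)
    where import Data.Empty

-- An independent set F is free exactly when some edge xy has no neighbour in F.
-- Fix such an edge xy and a proper k-colouring.  Every colour class restricted
-- to the vertices outside N(x) ∪ N(y) is free, witnessed by xy itself, so it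
-- suffices to split N(x) ∪ N(y) into m free sets to obtain φ(G) ≤ k + m.
-- In general the singletons of N(x) ∪ N(y) do, since in a free graph every
-- set of at most one vertex is free; this gives m = d(xy).  If g(G) ≥ 5, four
-- sets suffice: when both x and y have further neighbours, take {x}, {y},
-- N(x) ∖ {y} and N(y) ∖ {x}, the last two being free by the edges y y′ and
-- x x′ to further neighbours; when y is pendant, take a free set containing x
-- with its untouched edge ab and split N[x] into {x}, N(x) ∩ N(a),
-- N(x) ∩ N(b) and the rest, the middle two having at most one vertex since
-- G has no 4-cycle.
module Submission where

open import Defs
open import Data.Bool using (Bool; true; false)
open import Data.Empty using (⊥-elim)
open import Data.Fin using (Fin; _≟_; splitAt; join) renaming (zero to fzero; suc to fsuc)
open import Data.Fin.Properties using (any?; all?; splitAt-join)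
open import Data.Fin.Subset using (Subset; _∈_; _∉_; _⊆_; _∪_; ∣_∣; ⁅_⁆)
open import Data.Fin.Subset.Properties
  using (_∈?_; p⊆p∪q; q⊆p∪q; x∈p∪q⁻; x∈⁅x⁆; x∈⁅y⁆⇒x≡y; ⊆-antisym)
open import Data.List using (List; []; _∷_; allFin)
import Data.List.Relation.Unary.All as All
open import Data.List.Membership.Propositional.Properties using (∈-allFin)
open import Data.Maybe using (Maybe; just; nothing)
import Data.Maybe as Maybe
open import Data.Nat using (ℕ; zero; suc; _≤_; _+_; z≤n)
open import Data.Nat.Properties using (≤-refl)
open import Data.Product using (_×_; Σ-syntax; _,_; proj₁; proj₂)
open import Data.Sum using (_⊎_; inj₁; inj₂)
open import Data.Vec using (_∷_; tabulate; here; there)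
open import Data.Vec.Properties using (lookup∘tabulate; []=⇒lookup; lookup⇒[]=)
open import Relation.Nullary using (¬_; Dec; yes; no; does)
open import Relation.Nullary.Decidable using (_×-dec_; _→-dec_; ¬?; dec-true)
open import Relation.Binary.PropositionalEquality
  using (_≡_; _≢_; refl; sym; trans; cong; subst)

∈-tabulate⁺ : ∀ {n} {g : Fin n → Bool} {w} → g w ≡ true → w ∈ tabulate g
∈-tabulate⁺ {g = g} {w} gw = lookup⇒[]= w _ (trans (lookup∘tabulate g w) gw)

∈-tabulate⁻ : ∀ {n} {g : Fin n → Bool} {w} → w ∈ tabulate g → g w ≡ true
∈-tabulate⁻ {g = g} {w} w∈ = trans (sym (lookup∘tabulate g w)) ([]=⇒lookup w∈)

dec-true⁻ : ∀ {A : Set} (a? : Dec A) → does a? ≡ true → A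
dec-true⁻ (yes a) _ = a

position : ∀ {n} (D : Subset n) → Fin n → Maybe (Fin ∣ D ∣)
position (true  ∷ D) fzero    = just fzero
position (false ∷ D) fzero    = nothing
position (true  ∷ D) (fsuc w) = Maybe.map fsuc (position D w)
position (false ∷ D) (fsuc w) = position D w

position-nothing : ∀ {n} (D : Subset n) {w} → position D w ≡ nothing → w ∉ D
position-nothing (true  ∷ D) {fzero}  () here
position-nothing (true  ∷ D) {fsuc w} eq (there w∈D) with position D w in eq′
... | nothing = position-nothing D eq′ w∈D
position-nothing (false ∷ D) {fsuc w} eq (there w∈D) = position-nothing D eq w∈D

position-injective : ∀ {n} (D : Subset n) {a b j} →
  position D a ≡ just j → position D b ≡ just j → a ≡ b
position-injective (true  ∷ D) {fzero}  {fzero}  refl refl = refl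
position-injective (true  ∷ D) {fzero}  {fsuc b} refl eq with position D b
position-injective (true  ∷ D) {fzero}  {fsuc b} refl () | just _
position-injective (true  ∷ D) {fsuc a} {fzero}  eq refl with position D a
position-injective (true  ∷ D) {fsuc a} {fzero}  () refl | just _
position-injective (true  ∷ D) {fsuc a} {fsuc b} eqa eqb
  with position D a in pa | position D b in pb
position-injective (true ∷ D) {fsuc a} {fsuc b} refl refl | just _ | just _ =
  cong fsuc (position-injective D pa pb)
position-injective (false ∷ D) {fsuc a} {fsuc b} eqa eqb =
  cong fsuc (position-injective D eqa eqb)

firstOf : ∀ {A B C D : Set} → Dec A → Dec B → Dec C → Dec D → Maybe (Fin 4)
firstOf (yes _) _       _       _       = just fzero
firstOf (no _)  (yes _) _       _       = just (fsuc fzero)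
firstOf (no _)  (no _)  (yes _) _       = just (fsuc (fsuc fzero))
firstOf (no _)  (no _)  (no _)  (yes _) = just (fsuc (fsuc (fsuc fzero)))
firstOf (no _)  (no _)  (no _)  (no _)  = nothing

FirstOf : (A B C D : Set) → Fin 4 → Set
FirstOf A B C D fzero                      = A
FirstOf A B C D (fsuc fzero)               = ¬ A × B
FirstOf A B C D (fsuc (fsuc fzero))        = ¬ A × ¬ B × C
FirstOf A B C D (fsuc (fsuc (fsuc fzero))) = ¬ A × ¬ B × ¬ C × D

firstOf-just : ∀ {A B C D : Set} (a? : Dec A) (b? : Dec B) (c? : Dec C) (d? : Dec D) {j} →
  firstOf a? b? c? d? ≡ just j → FirstOf A B C D j
firstOf-just (yes a) _       _       _       refl = a
firstOf-just (no ¬a) (yes b) _       _       refl = ¬a , b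
firstOf-just (no ¬a) (no ¬b) (yes c) _       refl = ¬a , ¬b , c
firstOf-just (no ¬a) (no ¬b) (no ¬c) (yes d) refl = ¬a , ¬b , ¬c , d

firstOf-nothing : ∀ {A B C D : Set} (a? : Dec A) (b? : Dec B) (c? : Dec C) (d? : Dec D) →
  firstOf a? b? c? d? ≡ nothing → ¬ A × ¬ B × ¬ C × ¬ D
firstOf-nothing (no ¬a) (no ¬b) (no ¬c) (no ¬d) refl = ¬a , ¬b , ¬c , ¬d

module _ {n : ℕ} (G : Graph n) where
  open Graph G renaming (sym to Adj-sym)

  ∈-colorClass⁻ : ∀ {t} {c : Fin n → Fin t} {i w} → w ∈ colorClass G c i → c w ≡ i
  ∈-colorClass⁻ {c = c} {i} {w} w∈ = dec-true⁻ (c w ≟ i) (∈-tabulate⁻ w∈)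

  adj⇒∈N : ∀ {u w} → Adj u w → w ∈ N G u
  adj⇒∈N {u} {w} uw = ∈-tabulate⁺ (dec-true (adj? u w) uw)

  independent? : ∀ F → Dec (Independent G F)
  independent? F = all? λ u → all? λ v → (u ∈? F) →-dec ((v ∈? F) →-dec ¬? (adj? u v))

  independent-⊆ : ∀ {A B} → A ⊆ B → Independent G B → Independent G A
  independent-⊆ A⊆B indB u v u∈ v∈ = indB u v (A⊆B u∈) (A⊆B v∈)

  independent-∪⁅⁆ : ∀ {S x} → Independent G S → (∀ s → s ∈ S → ¬ Adj s x) →
    Independent G (S ∪ ⁅ x ⁆)
  independent-∪⁅⁆ {S} {x} indS far a b a∈ b∈
    with x∈p∪q⁻ S ⁅ x ⁆ a∈ | x∈p∪q⁻ S ⁅ x ⁆ b∈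
  ... | inj₁ a∈S | inj₁ b∈S = indS a b a∈S b∈S
  ... | inj₁ a∈S | inj₂ b∈x rewrite x∈⁅y⁆⇒x≡y x b∈x = far a a∈S
  ... | inj₂ a∈x | inj₁ b∈S rewrite x∈⁅y⁆⇒x≡y x a∈x = λ xb → far b b∈S (Adj-sym xb)
  ... | inj₂ a∈x | inj₂ b∈x rewrite x∈⁅y⁆⇒x≡y x a∈x | x∈⁅y⁆⇒x≡y x b∈x = irrefl

  Saturated : Subset n → Fin n → Set
  Saturated M w = w ∈ M ⊎ ¬ Independent G (M ∪ ⁅ w ⁆)

  saturated-⊆ : ∀ {M M′ w} → M ⊆ M′ → Saturated M w → Saturated M′ w
  saturated-⊆ M⊆M′ (inj₁ w∈M) = inj₁ (M⊆M′ w∈M)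
  saturated-⊆ {M} {M′} {w} M⊆M′ (inj₂ dep) = inj₂ λ ind → dep (independent-⊆ M∪w⊆M′∪w ind)
    where
    M∪w⊆M′∪w : M ∪ ⁅ w ⁆ ⊆ M′ ∪ ⁅ w ⁆
    M∪w⊆M′∪w v∈ with x∈p∪q⁻ M ⁅ w ⁆ v∈
    ... | inj₁ v∈M = p⊆p∪q _ (M⊆M′ v∈M)
    ... | inj₂ v∈w = q⊆p∪q M′ _ v∈w

  saturateAt : ∀ {S} → Independent G S → ∀ w →
    Σ[ S′ ∈ Subset n ] (Independent G S′ × S ⊆ S′ × Saturated S′ w)
  saturateAt {S} indS w with independent? (S ∪ ⁅ w ⁆)
  ... | yes indS′ = S ∪ ⁅ w ⁆ , indS′ , p⊆p∪q _ , inj₁ (q⊆p∪q S _ (x∈⁅x⁆ w))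
  ... | no dep    = S , indS , (λ s∈ → s∈) , inj₂ dep

  saturate : ∀ (ws : List (Fin n)) {S} → Independent G S →
    Σ[ M ∈ Subset n ] (Independent G M × S ⊆ M × All.All (Saturated M) ws)
  saturate []       indS = _ , indS , (λ s∈ → s∈) , All.[]
  saturate (w ∷ ws) indS with saturateAt indS w
  ... | S′ , indS′ , S⊆S′ , satw with saturate ws indS′
  ... | M , indM , S′⊆M , sat =
    M , indM , (λ s∈ → S′⊆M (S⊆S′ s∈)) , saturated-⊆ S′⊆M satw All.∷ sat

  extendToMaximal : ∀ {S} → Independent G S →
    Σ[ M ∈ Subset n ] (MaximalIndependent G M × S ⊆ M)
  extendToMaximal indS with saturate (allFin n) indS
  ... | M , indM , S⊆M , sat = M , (indM , maximal) , S⊆M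
    where
    maximal : ∀ F → Independent G F → M ⊆ F → F ≡ M
    maximal F indF M⊆F = ⊆-antisym F⊆M M⊆F
      where
      F⊆M : F ⊆ M
      F⊆M {w} w∈F with All.lookup sat (∈-allFin w)
      ... | inj₁ w∈M = w∈M
      ... | inj₂ dep = ⊥-elim (dep (independent-⊆ M∪w⊆F indF))
        where
        M∪w⊆F : M ∪ ⁅ w ⁆ ⊆ F
        M∪w⊆F v∈ with x∈p∪q⁻ M ⁅ w ⁆ v∈
        ... | inj₁ v∈M = M⊆F v∈M
        ... | inj₂ v∈w rewrite x∈⁅y⁆⇒x≡y w v∈w = w∈F

  maximal-dominating : ∀ {M w} → MaximalIndependent G M → w ∉ M →
    Σ[ x ∈ Fin n ] (x ∈ M × Adj w x)
  maximal-dominating {M} {w} (indM , maximal) w∉M with any? (λ x → (x ∈? M) ×-dec adj? w x)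
  ... | yes dominated = dominated
  ... | no undominated =
    ⊥-elim (w∉M (subst (w ∈_) (maximal _ indM∪w (p⊆p∪q _)) (q⊆p∪q M _ (x∈⁅x⁆ w))))
    where
    indM∪w : Independent G (M ∪ ⁅ w ⁆)
    indM∪w = independent-∪⁅⁆ indM λ x x∈M xw → undominated (x , x∈M , Adj-sym xw)

  UntouchedEdge : Subset n → Set
  UntouchedEdge F =
    Σ[ x ∈ Fin n ] Σ[ y ∈ Fin n ] (Adj x y × (∀ f → f ∈ F → ¬ Adj f x × ¬ Adj f y))

  untouchedEdge⇒free : ∀ {F} → Independent G F → UntouchedEdge F → FreeIndependent G F
  untouchedEdge⇒free {F} indF (x , y , xy , untouched)
    with extendToMaximal (independent-∪⁅⁆ indF λ f f∈ → proj₁ (untouched f f∈))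
       | extendToMaximal (independent-∪⁅⁆ indF λ f f∈ → proj₂ (untouched f f∈))
  ... | Mx , maxMx , F∪x⊆Mx | My , maxMy , F∪y⊆My =
    indF , Mx , My , maxMx , maxMy ,
    (λ f∈ → F∪x⊆Mx (p⊆p∪q _ f∈)) , (λ f∈ → F∪y⊆My (p⊆p∪q _ f∈)) , Mx≢My
    where
    Mx≢My : Mx ≢ My
    Mx≢My Mx≡My = proj₁ maxMx x y (F∪x⊆Mx (q⊆p∪q F _ (x∈⁅x⁆ x)))
      (subst (y ∈_) (sym Mx≡My) (F∪y⊆My (q⊆p∪q F _ (x∈⁅x⁆ y)))) xy

  free⇒untouchedEdge : ∀ {F} → FreeIndependent G F → UntouchedEdge F
  free⇒untouchedEdge {F} (_ , M₁ , M₂ , max₁ , max₂ , F⊆M₁ , F⊆M₂ , M₁≢M₂)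
    with any? (λ w → (w ∈? M₁) ×-dec ¬? (w ∈? M₂))
  ... | yes (w , w∈M₁ , w∉M₂) with maximal-dominating max₂ w∉M₂
  ... | x , x∈M₂ , wx =
    w , x , wx , λ f f∈ → proj₁ max₁ f w (F⊆M₁ f∈) w∈M₁ , proj₁ max₂ f x (F⊆M₂ f∈) x∈M₂
  free⇒untouchedEdge {F} (_ , M₁ , M₂ , max₁ , max₂ , F⊆M₁ , F⊆M₂ , M₁≢M₂)
    | no M₁⊈M₂ = ⊥-elim (M₁≢M₂ (sym (proj₂ max₁ M₂ (proj₁ max₂) M₁⊆M₂)))
    where
    M₁⊆M₂ : M₁ ⊆ M₂
    M₁⊆M₂ {w} w∈M₁ with w ∈? M₂
    ... | yes w∈M₂ = w∈M₂
    ... | no w∉M₂ = ⊥-elim (M₁⊈M₂ (w , w∈M₁ , w∉M₂))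

  free-⊆ : ∀ {S F} → S ⊆ F → FreeIndependent G F → FreeIndependent G S
  free-⊆ S⊆F (indF , M₁ , M₂ , max₁ , max₂ , F⊆M₁ , F⊆M₂ , M₁≢M₂) =
    independent-⊆ S⊆F indF , M₁ , M₂ , max₁ , max₂ ,
    (λ s∈ → F⊆M₁ (S⊆F s∈)) , (λ s∈ → F⊆M₂ (S⊆F s∈)) , M₁≢M₂

  -- The vertex is needed for S = ∅, which is free only if G has an edge.
  subsingleton-free : FreeGraph G → Fin n → ∀ {S} → (∀ a b → a ∈ S → b ∈ S → a ≡ b) →
    FreeIndependent G S
  subsingleton-free free v {S} subsingleton with any? (_∈? S)
  ... | yes (w , w∈S) with free w
  ... | F , freeF , w∈F =
    free-⊆ (λ {a} a∈S → subst (_∈ F) (sym (subsingleton a w a∈S w∈S)) w∈F) freeF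
  subsingleton-free free v {S} subsingleton | no empty with free v
  ... | F , freeF , _ = free-⊆ (λ {a} a∈S → ⊥-elim (empty (a , a∈S))) freeF

  record FreeCover (m : ℕ) : Set where
    field
      class      : Fin n → Maybe (Fin m)
      x y        : Fin n
      edge       : Adj x y
      unclassed  : ∀ w → class w ≡ nothing → ¬ Adj w x × ¬ Adj w y
      class-free : ∀ j S → (∀ w → w ∈ S → class w ≡ just j) → FreeIndependent G S

  freeColorable-+ : ∀ {k m} → Colorable G k → FreeCover m → FreeColorable G (k + m)
  freeColorable-+ {k} {m} (c , proper) cover = colour , colourClass-free
    where
    open FreeCover cover

    tag : Fin k → Maybe (Fin m) → Fin k ⊎ Fin m
    tag a nothing  = inj₁ a
    tag a (just j) = inj₂ j

    tag-inj₁ : ∀ {a s i} → tag a s ≡ inj₁ i → s ≡ nothing × a ≡ i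
    tag-inj₁ {s = nothing} refl = refl , refl

    tag-inj₂ : ∀ {a s j} → tag a s ≡ inj₂ j → s ≡ just j
    tag-inj₂ {s = just _} refl = refl

    colour : Fin n → Fin (k + m)
    colour w = join k m (tag (c w) (class w))

    tag-colourClass : ∀ {i w} → w ∈ colorClass G colour i → tag (c w) (class w) ≡ splitAt k i
    tag-colourClass w∈ =
      trans (sym (splitAt-join k m _)) (cong (splitAt k) (∈-colorClass⁻ {c = colour} w∈))

    colourClass-free : ∀ i → FreeIndependent G (colorClass G colour i)
    colourClass-free i with splitAt k i in split
    ... | inj₁ i′ = untouchedEdge⇒free independent
                      (x , y , edge , λ w w∈ → unclassed w (proj₁ (inClass w∈)))
      where
      inClass : ∀ {w} → w ∈ colorClass G colour i → class w ≡ nothing × c w ≡ i′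
      inClass w∈ = tag-inj₁ (trans (tag-colourClass w∈) split)
      independent : Independent G (colorClass G colour i)
      independent a b a∈ b∈ ab = proper a b ab (trans (proj₂ (inClass a∈)) (sym (proj₂ (inClass b∈))))
    ... | inj₂ j = class-free j _ λ w w∈ → tag-inj₂ (trans (tag-colourClass w∈) split)

  neighbourhoodCover : FreeGraph G → ∀ {u v} → Adj u v → FreeCover (d-edge G u v)
  neighbourhoodCover free {u} {v} uv = record
    { class      = position D
    ; x          = u
    ; y          = v
    ; edge       = uv
    ; unclassed  = λ w unpositioned →
        (λ wu → position-nothing D unpositioned (p⊆p∪q _ (adj⇒∈N (Adj-sym wu))))
      , (λ wv → position-nothing D unpositioned (q⊆p∪q (N G u) _ (adj⇒∈N (Adj-sym wv))))
    ; class-free = λ j S inClass → subsingleton-free free u λ a b a∈ b∈ →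
        position-injective D (inClass a a∈) (inClass b b∈)
    }
    where
    D : Subset n
    D = N G u ∪ N G v

  neighbourhood-independent : NoTriangle G → ∀ {p S} → (∀ f → f ∈ S → Adj p f) → Independent G S
  neighbourhood-independent noTriangle {p} inN a b a∈ b∈ ab =
    noTriangle p a b (inN a a∈) ab (Adj-sym (inN b b∈))

  commonNeighbour-unique : Girth≥5 G → ∀ {a c w w′} → a ≢ c →
    Adj a w → Adj c w → Adj a w′ → Adj c w′ → w ≡ w′
  commonNeighbour-unique (_ , noSquare) {a} {c} {w} {w′} a≢c aw cw aw′ cw′ with w ≟ w′
  ... | yes w≡w′ = w≡w′
  ... | no w≢w′  = ⊥-elim (noSquare a w c w′ a≢c w≢w′ aw (Adj-sym cw) cw′ (Adj-sym aw′))

  commonNeighbours-free : FreeGraph G → Girth≥5 G → ∀ {a c S} → a ≢ c →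
    (∀ w → w ∈ S → Adj a w × Adj c w) → FreeIndependent G S
  commonNeighbours-free free g5 {a} a≢c common = subsingleton-free free a λ w w′ w∈ w′∈ →
    let (aw , cw) = common w w∈ ; (aw′ , cw′) = common w′ w′∈
    in commonNeighbour-unique g5 a≢c aw cw aw′ cw′

  -- Witnessed by the untouched edge qr.
  neighbourhood-free : Girth≥5 G → ∀ {p q r S} → Adj p q → Adj q r → r ≢ p →
    (∀ f → f ∈ S → Adj p f × f ≢ q) → FreeIndependent G S
  neighbourhood-free g5@(noTriangle , _) {p} {q} {r} pq qr r≢p inS =
    untouchedEdge⇒free (neighbourhood-independent noTriangle λ f f∈ → proj₁ (inS f f∈))
      (q , r , qr , λ f f∈ → let (pf , f≢q) = inS f f∈ in
          (λ fq → noTriangle p f q pf fq (Adj-sym pq))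
        , (λ fr → f≢q (commonNeighbour-unique g5 (λ p≡r → r≢p (sym p≡r))
                         pf (Adj-sym fr) pq (Adj-sym qr))))

  innerEdgeCover : FreeGraph G → Girth≥5 G → ∀ {u v u′ v′} → Adj u v →
    Adj u u′ → u′ ≢ v → Adj v v′ → v′ ≢ u → FreeCover 4
  innerEdgeCover free g5 {u} {v} uv uu′ u′≢v vv′ v′≢u = record
    { class      = class
    ; x          = u
    ; y          = v
    ; edge       = uv
    ; unclassed  = λ w unclassed →
        let (_ , _ , ¬uw , ¬vw) = firstOf-nothing (w ≟ u) (w ≟ v) (adj? u w) (adj? v w) unclassed
        in (λ wu → ¬uw (Adj-sym wu)) , (λ wv → ¬vw (Adj-sym wv))
    ; class-free = classFree
    }
    where
    class : Fin n → Maybe (Fin 4)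
    class w = firstOf (w ≟ u) (w ≟ v) (adj? u w) (adj? v w)

    inClass : ∀ {j S} → (∀ w → w ∈ S → class w ≡ just j) →
      ∀ w → w ∈ S → FirstOf (w ≡ u) (w ≡ v) (Adj u w) (Adj v w) j
    inClass S⊆ w w∈ = firstOf-just (w ≟ u) (w ≟ v) (adj? u w) (adj? v w) (S⊆ w w∈)

    classFree : ∀ j S → (∀ w → w ∈ S → class w ≡ just j) → FreeIndependent G S
    classFree fzero S S⊆ = subsingleton-free free u λ a b a∈ b∈ →
      trans (inClass S⊆ a a∈) (sym (inClass S⊆ b b∈))
    classFree (fsuc fzero) S S⊆ = subsingleton-free free u λ a b a∈ b∈ →
      trans (proj₂ (inClass S⊆ a a∈)) (sym (proj₂ (inClass S⊆ b b∈)))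
    classFree (fsuc (fsuc fzero)) S S⊆ = neighbourhood-free g5 uv vv′ v′≢u λ f f∈ →
      let (_ , f≢v , uf) = inClass S⊆ f f∈ in uf , f≢v
    classFree (fsuc (fsuc (fsuc fzero))) S S⊆ = neighbourhood-free g5 (Adj-sym uv) uu′ u′≢v λ f f∈ →
      let (f≢u , _ , _ , vf) = inClass S⊆ f f∈ in vf , f≢u

  OtherNeighbour : Fin n → Fin n → Set
  OtherNeighbour v u = Σ[ w ∈ Fin n ] (Adj v w × w ≢ u)

  otherNeighbour? : ∀ v u → Dec (OtherNeighbour v u)
  otherNeighbour? v u = any? (λ w → adj? v w ×-dec ¬? (w ≟ u))

  pendantEdgeCover : FreeGraph G → Girth≥5 G → ∀ {u v} → Adj u v →
    ¬ OtherNeighbour v u → FreeCover 4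
  pendantEdgeCover free g5@(noTriangle , _) {u} {v} uv pendant
    with free u
  ... | F , freeF , u∈F with free⇒untouchedEdge freeF
  ... | a , b , ab , untouched = record
    { class      = class
    ; x          = u
    ; y          = v
    ; edge       = uv
    ; unclassed  = λ w unclassed →
        let (w≢u , _ , _ , ¬uw) = firstOf-nothing (w ≟ u) (adj? u w ×-dec adj? a w)
                                    (adj? u w ×-dec adj? b w) (adj? u w) unclassed
        in (λ wu → ¬uw (Adj-sym wu)) , (λ wv → pendant (w , Adj-sym wv , w≢u))
    ; class-free = classFree
    }
    where
    ¬ua : ¬ Adj u a
    ¬ua = proj₁ (untouched u u∈F)
    ¬ub : ¬ Adj u b
    ¬ub = proj₂ (untouched u u∈F)

    class : Fin n → Maybe (Fin 4)
    class w = firstOf (w ≟ u) (adj? u w ×-dec adj? a w) (adj? u w ×-dec adj? b w) (adj? u w)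

    inClass : ∀ {j S} → (∀ w → w ∈ S → class w ≡ just j) → ∀ w → w ∈ S →
      FirstOf (w ≡ u) (Adj u w × Adj a w) (Adj u w × Adj b w) (Adj u w) j
    inClass S⊆ w w∈ = firstOf-just (w ≟ u) (adj? u w ×-dec adj? a w)
                        (adj? u w ×-dec adj? b w) (adj? u w) (S⊆ w w∈)

    classFree : ∀ j S → (∀ w → w ∈ S → class w ≡ just j) → FreeIndependent G S
    classFree fzero S S⊆ = subsingleton-free free u λ w w′ w∈ w′∈ →
      trans (inClass S⊆ w w∈) (sym (inClass S⊆ w′ w′∈))
    classFree (fsuc fzero) S S⊆ =
      commonNeighbours-free free g5 (λ { refl → ¬ub ab }) λ w w∈ → proj₂ (inClass S⊆ w w∈)
    classFree (fsuc (fsuc fzero)) S S⊆ =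
      commonNeighbours-free free g5 (λ { refl → ¬ua (Adj-sym ab) }) λ w w∈ →
        proj₂ (proj₂ (inClass S⊆ w w∈))
    classFree (fsuc (fsuc (fsuc fzero))) S S⊆ =
      untouchedEdge⇒free
        (neighbourhood-independent noTriangle λ f f∈ → proj₂ (proj₂ (proj₂ (inClass S⊆ f f∈))))
        (a , b , ab , λ f f∈ → let (_ , ¬ua∧af , ¬ub∧bf , uf) = inClass S⊆ f f∈ in
          (λ fa → ¬ua∧af (uf , Adj-sym fa)) , (λ fb → ¬ub∧bf (uf , Adj-sym fb)))

  girth≥5Cover : FreeGraph G → Girth≥5 G → ∀ {u v} → Adj u v → FreeCover 4
  girth≥5Cover free g5 {u} {v} uv with otherNeighbour? v u | otherNeighbour? u v
  ... | no pendant | _          = pendantEdgeCover free g5 uv pendant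
  ... | yes _      | no pendant = pendantEdgeCover free g5 (Adj-sym uv) pendant
  ... | yes (v′ , vv′ , v′≢u) | yes (u′ , uu′ , u′≢v) =
    innerEdgeCover free g5 uv uu′ u′≢v vv′ v′≢u

freeChromatic≤χ+4 : ∀ {n} (G : Graph n) → FreeGraph G → Girth≥5 G → (k : ℕ) → Colorable G k →
  Σ[ t ∈ ℕ ] (t ≤ k + 4 × FreeColorable G t)
-- With no vertices every colour class is empty, and ∅ is not free.
freeChromatic≤χ+4 {zero}  G free g5 k χ = 0 , z≤n , (λ ()) , λ ()
freeChromatic≤χ+4 {suc _} G free g5 k χ with free⇒untouchedEdge G (proj₁ (proj₂ (free fzero)))
... | x , y , xy , _ = k + 4 , ≤-refl , freeColorable-+ G χ (girth≥5Cover G free g5 xy)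

mainTheorem4 : (n : ℕ) (G : Graph n) → FreeGraph G →
    ((k : ℕ) → Colorable G k →
      (u v : Fin n) → Graph.Adj G u v →
        Σ[ t ∈ ℕ ] (t ≤ k + d-edge G u v × FreeColorable G t))
    ×
    (Girth≥5 G → (k : ℕ) → Colorable G k →
        Σ[ t ∈ ℕ ] (t ≤ k + 4 × FreeColorable G t))
mainTheorem4 n G free =
    (λ k χ u v uv → k + d-edge G u v , ≤-refl , freeColorable-+ G χ (neighbourhoodCover G free uv))
  , freeChromatic≤χ+4 G free
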